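{- Let $k\ge 2$ be an integer and let $J_k$ be the $k\times k$ permutation matrix whose $1$ entries are exactly at positions $(i,i+1)$ for $1\le i\le k-1$ and $(k,1)$. Then for all integers $m,n\ge k$, \[sat(J_k,m,n)\ge (k-2)\max(m,n)+m+n-1-\frac{(k-2)(k-1)}{2}.\]
   Context: All matrices are $0$-$1$ matrices; an $m\times n$ matrix has $m$ rows and $n$ columns. The weight of a matrix is its number of $1$ entries. A matrix $M$ contains a $k\times l$ pattern $P$ if there are rows $r_1<\dots<r_k$ and columns $c_1<\dots<c_l$ of $M$ such that $M(r_a,c_b)=1$ whenever $P(a,b)=1$; otherwise $M$ avoids $P$. A matrix $M$ is saturating for $P$ if $M$ avoids $P$ and changing any single $0$ entry of $M$ to $1$ yields a matrix containing $P$. $sat(P,m,n)$ is the minimum weight of an $m\times n$ matrix saturating for $P$. -}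

module Defs where

open import Data.Nat using (ℕ; zero; suc; _+_; _*_; _∸_; _<_; _≤_; _⊔_)
open import Data.Nat.Properties using (_≟_)
open import Data.Bool using (Bool; true; false; _∨_; _∧_; if_then_else_)
open import Data.Fin using (Fin; toℕ)
open import Data.Product using (Σ; _×_; ∃)
open import Relation.Binary.PropositionalEquality using (_≡_)
open import Relation.Nullary using (¬_)
open import Relation.Nullary.Decidable using (⌊_⌋)
open import Data.Nat.ListAction using (sum)
open import Data.List.Base using () renaming (tabulate to tabulateL)

Matrix : ℕ → ℕ → Set
Matrix m n = Fin m → Fin n → Bool

Increasing : ∀ {a b} → (Fin a → Fin b) → Set
Increasing {a} f = ∀ (i j : Fin a) → toℕ i < toℕ j → toℕ (f i) < toℕ (f j)

Contains : ∀ {m n k l} → Matrix m n → Matrix k l → Set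
Contains {m} {n} {k} {l} M P =
  Σ (Fin k → Fin m) λ r → Σ (Fin l → Fin n) λ c →
    Increasing r × Increasing c ×
    (∀ a b → P a b ≡ true → M (r a) (c b) ≡ true)

Avoids : ∀ {m n k l} → Matrix m n → Matrix k l → Set
Avoids M P = ¬ Contains M P

flipOn : ∀ {m n} → Matrix m n → Fin m → Fin n → Matrix m n
flipOn M i j i' j' = (⌊ toℕ i ≟ toℕ i' ⌋ ∧ ⌊ toℕ j ≟ toℕ j' ⌋) ∨ M i' j'

Saturating : ∀ {m n k l} → Matrix m n → Matrix k l → Set
Saturating M P =
  Avoids M P × (∀ i j → M i j ≡ false → Contains (flipOn M i j) P)

weight : ∀ {m n} → Matrix m n → ℕ
weight {m} {n} M =
  sum (tabulateL {n = m} λ i → sum (tabulateL {n = n} λ j →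
    if M i j then 1 else 0))

J : (k : ℕ) → Matrix k k
J k i j = ⌊ toℕ j ≟ suc (toℕ i) ⌋ ∨ (⌊ toℕ i ≟ k ∸ 1 ⌋ ∧ ⌊ toℕ j ≟ 0 ⌋)

module Submission where

open import Defs
open import Data.Nat using (ℕ; zero; suc; _+_; _*_; _∸_; _≤_; _<_; _⊔_; z≤n; s≤s; s≤s⁻¹; z<s; _≤?_; _<?_; _≟_)
open import Data.Nat.Properties
open import Data.Nat.ListAction using (sum)
open import Data.Nat.Tactic.RingSolver using (solve-∀)
open import Data.Bool using (Bool; true; false; _∨_; if_then_else_)
open import Data.Bool.Properties using (∨-zeroʳ)
open import Data.Fin using (Fin; toℕ; fromℕ; fromℕ<; inject₁; opposite) renaming (zero to fzero; suc to fsuc)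
open import Data.Fin.Properties
  using (toℕ-fromℕ; fromℕ<-toℕ; toℕ-fromℕ<; toℕ-inject₁; toℕ<n; toℕ-injective; opposite-prop; opposite-involutive)
import Data.Fin.Permutation as Perm
open import Data.List.Base using (List; []; _∷_; _++_; length; foldr; take; drop; tabulate; initLast; _∷ʳ′_)
open import Data.List.Properties
  using (length-++; length-take; length-drop; take++drop≡id; length-tabulate; tabulate-cong)
open import Data.List.Relation.Unary.All as All using (All; []; _∷_)
open import Data.List.Relation.Unary.All.Properties using (++⁺; ++⁻ˡ; ++⁻ʳ; take⁺; ¬All⇒Any¬; ¬Any⇒All¬; tabulate⁺)
open import Data.List.Relation.Unary.Any as Any using (Any; here; there)
open import Data.List.Relation.Unary.AllPairs as AllPairs using (AllPairs; []; _∷_)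
import Data.List.Relation.Unary.AllPairs.Properties as AllPairsₚ
open import Data.List.Membership.Propositional.Properties using (∈-∃++)
open import Data.Product using (Σ; _×_; _,_; proj₁; proj₂)
open import Data.Product.Properties using (≡-dec)
open import Data.List.Membership.DecPropositional (≡-dec _≟_ _≟_) using (_∈?_)
open import Data.Sum using (_⊎_; inj₁; inj₂)
open import Data.Empty using (⊥-elim)
open import Function using (_∘_)
open import Level using (0ℓ)
open import Relation.Binary.PropositionalEquality hiding (J)
open import Relation.Nullary using (¬_; yes; no)
open import Relation.Unary using (Pred; _∩_; _∪_)
import Algebra.Properties.CommutativeMonoid.Sum +-0-commutativeMonoid as ∑
import Algebra.Properties.CommutativeSemigroup +-commutativeSemigroup as +-CS

-- Write K = k − 1.  We show that a saturating (m + 1) × n matrix has weight at least K·m + n;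
-- reflecting in the anti-diagonal, which fixes J_k, swaps the roles of m and n, and the larger of
-- the two bounds gives the theorem.
--
-- A copy of J_k is a 1 (its corner) with a chain of K ones strictly north-east of it, and
-- switching on a zero z creates a copy with z as its corner or on its chain.  Let lead r be the
-- column of the first 1 of row r.  A zero right of lead r cannot be a corner, and a zero left of
-- it cannot lie on a chain; hence lead 0 = 0, lead is monotone, row r is full between lead r and
-- lead (r + 1), and the last row is full from its lead on.  The heart of the proof is that row i
-- has at least K ones in the columns from c = lead (i + 1) on.  The last zero x of row i beyond c
-- lies on the chain pre ++ x ∷ post of a copy; post lies in the full part of the row, and pre,
-- like every chain of ones above row i between columns c and x, is shorter than the number of
-- ones of row i in [c, x): a chain running into the column of a zero of row i can be rerouted
-- around it by crossing it with the chain of that zero's copy.  Summing over the rows, the leads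
-- telescope to n.

sumFrom : (ℕ → ℕ) → ℕ → ℕ → ℕ
sumFrom h a zero = 0
sumFrom h a (suc d) = h a + sumFrom h (suc a) d

sumFrom-+ : ∀ h a d e → sumFrom h a (d + e) ≡ sumFrom h a d + sumFrom h (a + d) e
sumFrom-+ h a zero e = cong (λ a′ → sumFrom h a′ e) (sym (+-identityʳ a))
sumFrom-+ h a (suc d) e = begin
  h a + sumFrom h (suc a) (d + e)                         ≡⟨ cong (h a +_) (sumFrom-+ h (suc a) d e) ⟩
  h a + (sumFrom h (suc a) d + sumFrom h (suc a + d) e)   ≡⟨ sym (+-assoc (h a) _ _) ⟩
  sumFrom h a (suc d) + sumFrom h (suc a + d) e
    ≡⟨ cong (λ a′ → sumFrom h a (suc d) + sumFrom h a′ e) (sym (+-suc a d)) ⟩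
  sumFrom h a (suc d) + sumFrom h (a + suc d) e           ∎
  where open ≡-Reasoning

sumFrom-snoc : ∀ h a d → sumFrom h a (suc d) ≡ sumFrom h a d + h (a + d)
sumFrom-snoc h a d = begin
  sumFrom h a (suc d)                  ≡⟨ cong (sumFrom h a) (+-comm 1 d) ⟩
  sumFrom h a (d + 1)                  ≡⟨ sumFrom-+ h a d 1 ⟩
  sumFrom h a d + (h (a + d) + 0)      ≡⟨ cong (sumFrom h a d +_) (+-identityʳ _) ⟩
  sumFrom h a d + h (a + d)            ∎
  where open ≡-Reasoning

sumFrom-split : ∀ h {a b c} → a ≤ b → b ≤ c →
  sumFrom h a (c ∸ a) ≡ sumFrom h a (b ∸ a) + sumFrom h b (c ∸ b)
sumFrom-split h {a} {b} {c} a≤b b≤c = begin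
  sumFrom h a (c ∸ a)                                     ≡⟨ cong (sumFrom h a) c∸a≡ ⟩
  sumFrom h a ((b ∸ a) + (c ∸ b))                         ≡⟨ sumFrom-+ h a (b ∸ a) (c ∸ b) ⟩
  sumFrom h a (b ∸ a) + sumFrom h (a + (b ∸ a)) (c ∸ b)
    ≡⟨ cong (λ b′ → sumFrom h a (b ∸ a) + sumFrom h b′ (c ∸ b)) (m+[n∸m]≡n a≤b) ⟩
  sumFrom h a (b ∸ a) + sumFrom h b (c ∸ b)               ∎
  where
  open ≡-Reasoning
  c∸a≡ : c ∸ a ≡ (b ∸ a) + (c ∸ b)
  c∸a≡ = begin
    c ∸ a                  ≡⟨ cong (_∸ a) (sym (m∸n+n≡m b≤c)) ⟩
    (c ∸ b) + b ∸ a        ≡⟨ +-∸-assoc (c ∸ b) a≤b ⟩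
    (c ∸ b) + (b ∸ a)      ≡⟨ +-comm (c ∸ b) (b ∸ a) ⟩
    (b ∸ a) + (c ∸ b)      ∎

sumFrom-suffix-≤ : ∀ h {a c} → a ≤ c → sumFrom h a (c ∸ a) ≤ sumFrom h 0 c
sumFrom-suffix-≤ h {a} {c} a≤c = begin
  sumFrom h a (c ∸ a)                     ≤⟨ m≤n+m _ (sumFrom h 0 a) ⟩
  sumFrom h 0 a + sumFrom h a (c ∸ a)     ≡⟨ sumFrom-split h z≤n a≤c ⟨
  sumFrom h 0 c                           ∎
  where open ≤-Reasoning

sumFrom-const₁ : ∀ h a d → (∀ j → a ≤ j → j < a + d → h j ≡ 1) → sumFrom h a d ≡ d
sumFrom-const₁ h a zero _ = refl
sumFrom-const₁ h a (suc d) one =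
  cong₂ _+_ (one a ≤-refl (m<m+n a z<s)) (sumFrom-const₁ h (suc a) d one′)
  where
  one′ : ∀ j → suc a ≤ j → j < suc a + d → h j ≡ 1
  one′ j a<j j<a+d = one j (<⇒≤ a<j) (subst (j <_) (sym (+-suc a d)) j<a+d)

sum-tabulate : ∀ h a d (g : Fin d → ℕ) → (∀ j → g j ≡ h (a + toℕ j)) → sum (tabulate g) ≡ sumFrom h a d
sum-tabulate h a zero g g≗h = refl
sum-tabulate h a (suc d) g g≗h =
  cong₂ _+_ (trans (g≗h fzero) (cong h (+-identityʳ a)))
            (sum-tabulate h (suc a) d (g ∘ fsuc) (λ j → trans (g≗h (fsuc j)) (cong h (+-suc a (toℕ j)))))

telescope : ∀ (h g : ℕ → ℕ) K t → (∀ r → r < t → g (suc r) + K ≤ h r + g r) →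
  g t + K * t ≤ sumFrom h 0 t + g 0
telescope h g K zero _ = ≤-reflexive (trans (cong (g 0 +_) (*-zeroʳ K)) (+-identityʳ (g 0)))
telescope h g K (suc t) step = begin
  g (suc t) + K * suc t              ≡⟨ cong (g (suc t) +_) (*-suc K t) ⟩
  g (suc t) + (K + K * t)            ≡⟨ sym (+-assoc (g (suc t)) K (K * t)) ⟩
  g (suc t) + K + K * t              ≤⟨ +-monoˡ-≤ (K * t) (step t ≤-refl) ⟩
  h t + g t + K * t                  ≡⟨ +-assoc (h t) (g t) (K * t) ⟩
  h t + (g t + K * t)                ≤⟨ +-monoʳ-≤ (h t) (telescope h g K t (λ r r<t → step r (m<n⇒m<1+n r<t))) ⟩
  h t + (sumFrom h 0 t + g 0)        ≡⟨ sym (+-assoc (h t) _ (g 0)) ⟩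
  h t + sumFrom h 0 t + g 0          ≡⟨ cong (_+ g 0) (trans (+-comm (h t) _) (sym (sumFrom-snoc h 0 t))) ⟩
  sumFrom h 0 (suc t) + g 0          ∎
  where open ≤-Reasoning

-- The least j < d with f j ≡ true, or d if there is none.
firstTrue : (ℕ → Bool) → ℕ → ℕ
firstTrue f zero = zero
firstTrue f (suc d) = if f 0 then 0 else suc (firstTrue (f ∘ suc) d)

firstTrue-≤ : ∀ f d → firstTrue f d ≤ d
firstTrue-≤ f zero = z≤n
firstTrue-≤ f (suc d) with f 0
... | true = z≤n
... | false = s≤s (firstTrue-≤ (f ∘ suc) d)

<firstTrue⇒false : ∀ f d j → j < firstTrue f d → f j ≡ false
<firstTrue⇒false f (suc d) j j< with f 0 in f0
<firstTrue⇒false f (suc d) zero j< | false = f0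
<firstTrue⇒false f (suc d) (suc j) (s≤s j<) | false = <firstTrue⇒false (f ∘ suc) d j j<

firstTrue-true : ∀ f d → firstTrue f d < d → f (firstTrue f d) ≡ true
firstTrue-true f (suc d) lt with f 0 in f0
... | true = f0
... | false = firstTrue-true (f ∘ suc) d (s≤s⁻¹ lt)

below-suc : ∀ {P : ℕ → Set} {b j} → P b → (j < b → P j) → j < suc b → P j
below-suc Pb below j<1+b with m<1+n⇒m<n∨m≡n j<1+b
... | inj₁ j<b = below j<b
... | inj₂ refl = Pb

lastFalse : ∀ (f : ℕ → Bool) a b →
  (∀ j → a ≤ j → j < b → f j ≡ true) ⊎
  Σ ℕ λ x → a ≤ x × x < b × f x ≡ false × (∀ j → x < j → j < b → f j ≡ true)
lastFalse f a zero = inj₁ (λ _ _ ())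
lastFalse f a (suc b) with a ≤? b | f b in fb
... | no a≰b | _ = inj₁ (λ j a≤j j<1+b → ⊥-elim (a≰b (≤-trans a≤j (s≤s⁻¹ j<1+b))))
... | yes a≤b | false = inj₂ (b , a≤b , ≤-refl , fb , λ j b<j j<1+b → ⊥-elim (<⇒≱ b<j (s≤s⁻¹ j<1+b)))
... | yes a≤b | true with lastFalse f a b
...   | inj₁ allTrue = inj₁ (λ j a≤j j<1+b → below-suc fb (allTrue j a≤j) j<1+b)
...   | inj₂ (x , a≤x , x<b , fx , after) =
  inj₂ (x , a≤x , m<n⇒m<1+n x<b , fx , λ j x<j j<1+b → below-suc fb (after j x<j) j<1+b)

split-suffix : ∀ {A : Set} t (xs : List A) → t ≤ length xs →
  Σ (List A) λ ys → Σ (List A) λ zs → xs ≡ ys ++ zs × length zs ≡ t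
split-suffix t xs t≤ =
  take j xs , drop j xs , sym (take++drop≡id j xs) , trans (length-drop j xs) (m∸[m∸n]≡n t≤)
  where j = length xs ∸ t

Point : Set
Point = ℕ × ℕ

row col : Point → ℕ
row = proj₁
col = proj₂

_≺_ : Point → Point → Set
p ≺ q = row p < row q × col p < col q

_≼_ : Point → Point → Set
p ≼ q = row p ≤ row q × col p ≤ col q

≺-trans : ∀ {p q r} → p ≺ q → q ≺ r → p ≺ r
≺-trans (r₁ , c₁) (r₂ , c₂) = <-trans r₁ r₂ , <-trans c₁ c₂

≺-≼-trans : ∀ {p q r} → p ≺ q → q ≼ r → p ≺ r
≺-≼-trans (r₁ , c₁) (r₂ , c₂) = <-≤-trans r₁ r₂ , <-≤-trans c₁ c₂

≺⇒≼ : ∀ {p q} → p ≺ q → p ≼ q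
≺⇒≼ (r₁ , c₁) = <⇒≤ r₁ , <⇒≤ c₁

≼-refl : ∀ {p} → p ≼ p
≼-refl = ≤-refl , ≤-refl

≼-trans : ∀ {p q r} → p ≼ q → q ≼ r → p ≼ r
≼-trans (r₁ , c₁) (r₂ , c₂) = ≤-trans r₁ r₂ , ≤-trans c₁ c₂

≺⇒≢ : ∀ {p q} → p ≺ q → p ≢ q
≺⇒≢ (r< , _) refl = <-irrefl refl r<

-- Rows are numbered from the top, so north-east means an earlier row and a later column.
NE : Point → Point → Set
NE b p = row p < row b × col b < col p

NE⇒≢ : ∀ {b p} → NE b p → p ≢ b
NE⇒≢ (r< , _) refl = <-irrefl refl r<

Chain : List Point → Set
Chain = AllPairs _≺_

chain-++⁻ : ∀ xs {ys} → Chain (xs ++ ys) → Chain xs × Chain ys × All (λ x → All (x ≺_) ys) xs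
chain-++⁻ [] c = [] , c , []
chain-++⁻ (x ∷ xs) (x≺ ∷ c) with chain-++⁻ xs c
... | cxs , cys , sep = ++⁻ˡ xs x≺ ∷ cxs , cys , ++⁻ʳ xs x≺ ∷ sep

chain-++-via : ∀ (z : Point) {xs ys} → Chain xs → Chain ys →
  All (_≺ z) xs → All (z ≼_) ys → Chain (xs ++ ys)
chain-++-via z cxs cys below above =
  AllPairsₚ.++⁺ cxs cys (All.map (λ x≺z → All.map (≺-≼-trans x≺z) above) below)

chain-length-≤-columns : ∀ {xs} a b → Chain xs → All (λ p → a ≤ col p × col p < b) xs →
  length xs ≤ b ∸ a
chain-length-≤-columns a b [] [] = z≤n
chain-length-≤-columns a b (x≺ ∷ cxs) ((a≤x , x<b) ∷ inside) =
  ≤-trans (s≤s (chain-length-≤-columns (suc a) b cxs (All.zipWith shift (x≺ , inside))))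
          (≤-reflexive (sym (+-∸-assoc 1 (≤-<-trans a≤x x<b))))
  where
  shift : ∀ {p} → _ ≺ p × (a ≤ col p × col p < b) → suc a ≤ col p × col p < b
  shift ((_ , x<p) , (_ , p<b)) = ≤-<-trans a≤x x<p , p<b

split-at-column : ∀ a {P} → Chain P → Σ (List Point) λ Q → Σ (List Point) λ S →
  P ≡ Q ++ S × All (λ p → col p ≤ a) Q × All (λ p → a < col p) S
split-at-column a [] = [] , [] , refl , [] , []
split-at-column a {p ∷ P} (p≺P ∷ cP) with col p ≤? a
... | yes p≤a with split-at-column a cP
...   | Q , S , refl , Q≤a , a<S = p ∷ Q , S , refl , p≤a ∷ Q≤a , a<S
split-at-column a {p ∷ P} (p≺P ∷ cP) | no p≰a =
  [] , p ∷ P , refl , [] , ≰⇒> p≰a ∷ All.map (λ p≺q → <-trans (≰⇒> p≰a) (proj₂ p≺q)) p≺P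

frontier : List Point → Point
frontier = foldr (λ p π → suc (row p) ⊔ row π , suc (col p) ⊔ col π) (0 , 0)

≺-frontier : ∀ xs → All (_≺ frontier xs) xs
≺-frontier [] = []
≺-frontier (x ∷ xs) =
  (m≤m⊔n (suc (row x)) (row π) , m≤m⊔n (suc (col x)) (col π)) ∷
  All.map (λ p≺ → ≺-≼-trans p≺ (m≤n⊔m (suc (row x)) (row π) , m≤n⊔m (suc (col x)) (col π))) (≺-frontier xs)
  where π = frontier xs

frontier-row-≤ : ∀ {xs y} → All (λ p → row p < y) xs → row (frontier xs) ≤ y
frontier-row-≤ [] = z≤n
frontier-row-≤ (p<y ∷ below) = ⊔-lub p<y (frontier-row-≤ below)

frontier-col-≤ : ∀ {xs y} → All (λ p → col p < y) xs → col (frontier xs) ≤ y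
frontier-col-≤ [] = z≤n
frontier-col-≤ (p<y ∷ below) = ⊔-lub p<y (frontier-col-≤ below)

Exchanged : Pred Point 0ℓ → ℕ → Point → Point → ℕ → Set
Exchanged U x π c t =
  (Σ (List Point) λ R → Chain R × All U R × All (π ≼_) R × All (λ p → col p < x) R × length R ≡ t)
  ⊎ (Σ (List Point) λ X → Chain (c ∷ X) × All U X × length X ≡ t)

-- Either a prefix of s ∷ S continues into the matching suffix of c ∷ C, giving a chain of
-- length t left of column x and above π, or a prefix of c ∷ C continues into the matching
-- suffix of s ∷ S, giving a chain of length t + 1 that starts at c.
exchange : ∀ {U : Pred Point 0ℓ} {x} π s c (S C : List Point) → length S ≡ length C →
  Chain (s ∷ S) → Chain (c ∷ C) → All U (s ∷ S) → All U (c ∷ C) →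
  π ≼ s → col π ≤ col c → All (λ p → col p < x) (c ∷ C) → Any (λ p → x ≤ col p) (s ∷ S) →
  Exchanged U x π c (length (s ∷ S))
exchange {U} {x} π s c S C |S|≡|C| (s≺S ∷ cS) (c≺C ∷ cC) (Us ∷ US) (Uc ∷ UC) π≼s πc≤c
         (c<x ∷ C<x) x≤sS with row π ≤? row c | col c <? col s
... | yes πr≤c | _ = inj₁ (c ∷ C , c≺C ∷ cC , Uc ∷ UC , π≼c ∷ All.map (≼-trans π≼c ∘ ≺⇒≼) c≺C ,
                           c<x ∷ C<x , cong suc (sym |S|≡|C|))
  where π≼c = πr≤c , πc≤c
... | no πr≰c | yes c<s = inj₂ (s ∷ S , (c≺s ∷ All.map (≺-trans c≺s) s≺S) ∷ s≺S ∷ cS , Us ∷ US , refl)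
  where c≺s = <-≤-trans (≰⇒> πr≰c) (proj₁ π≼s) , c<s
... | no _ | no c≮s = pass S C |S|≡|C| s≺S cS US c≺C cC UC C<x x≤sS
  where
  s≤c : col s ≤ col c
  s≤c = ≮⇒≥ c≮s
  x≰s : ¬ x ≤ col s
  x≰s x≤s = <⇒≱ c<x (≤-trans x≤s s≤c)
  pass : ∀ S C → length S ≡ length C → All (s ≺_) S → Chain S → All U S →
    All (c ≺_) C → Chain C → All U C → All (λ p → col p < x) C → Any (λ p → x ≤ col p) (s ∷ S) →
    Exchanged U x π c (length (s ∷ S))
  pass S C _ _ _ _ _ _ _ _ (here x≤s) = ⊥-elim (x≰s x≤s)
  -- (suc (row s) , suc (col s)) ≼ r unfolds to s ≺ r.
  pass (s′ ∷ S) (c′ ∷ C) |S|≡|C| (s≺s′ ∷ _) cS US (c≺c′ ∷ _) cC UC C<x (there x≤S)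
    with exchange (suc (row s) , suc (col s)) s′ c′ S C (suc-injective |S|≡|C|) cS cC US UC
           s≺s′ (≤-<-trans s≤c (proj₂ c≺c′)) C<x x≤S
  ... | inj₁ (R , cR , UR , s≺R , R<x , |R|) =
    inj₁ (s ∷ R , s≺R ∷ cR , Us ∷ UR , π≼s ∷ All.map (≼-trans π≼s ∘ ≺⇒≼) s≺R ,
          ≤-<-trans s≤c c<x ∷ R<x , cong suc |R|)
  ... | inj₂ (X , c′X , UX , |X|) =
    inj₂ (c′ ∷ X , (c≺c′ ∷ All.map (≺-trans c≺c′) (AllPairs.head c′X)) ∷ c′X , All.head UC ∷ UX ,
          cong suc |X|)

IsOne : (ℕ → ℕ → Bool) → Point → Set
IsOne E p = E (row p) (col p) ≡ true

-- A copy of J_{K+1}: its 1 in the bottom-left corner at b, the other K ones forming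
-- the chain ch north-east of b.
Occurrence : Pred Point 0ℓ → ℕ → Point → List Point → Set
Occurrence U K b ch = U b × Chain ch × All (U ∩ NE b) ch × length ch ≡ K

module Saturated (m n K : ℕ) (E : ℕ → ℕ → Bool) (1≤K : 1 ≤ K) (K<n : K < n)
  (bounded : ∀ {p} → IsOne E p → row p < m × col p < n)
  (avoids : ∀ {b ch} → ¬ Occurrence (IsOne E) K b ch)
  (saturated : ∀ z → row z < m → col z < n → E (row z) (col z) ≡ false →
               Σ Point λ b → Σ (List Point) λ ch → Occurrence (IsOne E ∪ (_≡ z)) K b ch)
  where

  One Zero : Point → Set
  One = IsOne E
  Zero p = E (row p) (col p) ≡ false

  one-not-zero : ∀ {p} → One p → ¬ Zero p
  one-not-zero one-p zero-p with trans (sym one-p) zero-p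
  ... | ()

  NEChain : Point → Set
  NEChain z = Σ (List Point) λ ch → Chain ch × All (One ∩ NE z) ch × K ≤ length ch

  NEChain-at-one : ∀ {b} → One b → ¬ NEChain b
  NEChain-at-one {b} b-one (ch , cch , ok , K≤) =
    avoids (b-one , AllPairsₚ.take⁺ K cch , take⁺ K ok , trans (length-take K ch) (m≤n⇒m⊓n≡m K≤))

  NEChain-mono : ∀ {z z′} → row z ≤ row z′ → col z′ ≤ col z → NEChain z → NEChain z′
  NEChain-mono r≤ c≤ (ch , cch , ok , K≤) =
    ch , cch , All.map (λ { (one , r< , c<) → one , <-≤-trans r< r≤ , ≤-<-trans c≤ c< }) ok , K≤

  NEChain-witness : ∀ {z} → NEChain z → Σ Point (One ∩ NE z)
  NEChain-witness ([] , _ , _ , K≤0) = ⊥-elim (<⇒≱ 1≤K K≤0)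
  NEChain-witness (p ∷ _ , _ , ok ∷ _ , _) = p , ok

  record ChainThrough (z : Point) : Set where
    field
      corner : Point
      pre post : List Point
      corner-one : One corner
      z-NE : NE corner z
      pre-chain : Chain pre
      post-chain : Chain post
      pre-ok : All (One ∩ NE corner) pre
      post-ok : All (One ∩ NE corner) post
      pre≺z : All (_≺ z) pre
      z≺post : All (z ≺_) post
      length-pre-post : length pre + suc (length post) ≡ K

  one-unless-z : ∀ {z p} → (One ∪ (_≡ z)) p → p ≢ z → One p
  one-unless-z (inj₁ one) _ = one
  one-unless-z (inj₂ p≡z) p≢z = ⊥-elim (p≢z p≡z)

  zero-role : ∀ z → row z < m → col z < n → Zero z → NEChain z ⊎ ChainThrough z
  zero-role z r<m c<n z-zero with saturated z r<m c<n z-zero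
  ... | b , ch , inj₂ refl , cch , ok , |ch| =
    inj₁ (ch , cch , All.map (λ { (one-or-z , ne) → one-unless-z one-or-z (NE⇒≢ ne) , ne }) ok , ≤-reflexive (sym |ch|))
  ... | b , ch , inj₁ b-one , cch , ok , |ch| with z ∈? ch
  ...   | no z∉ch =
    ⊥-elim (avoids (b-one , cch , All.zipWith (λ { ((one-or-z , ne) , z≢p) → one-unless-z one-or-z (z≢p ∘ sym) , ne })
                                              (ok , ¬Any⇒All¬ ch z∉ch) , |ch|))
  ...   | yes z∈ch with ∈-∃++ z∈ch
  ...     | pre , post , refl with chain-++⁻ pre cch | ++⁻ˡ pre ok | ++⁻ʳ pre ok
  ...       | cpre , z≺post ∷ cpost , pre≺ | pre-ok | (_ , z-NE) ∷ post-ok = inj₂ (record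
    { corner = b ; pre = pre ; post = post ; corner-one = b-one ; z-NE = z-NE
    ; pre-chain = cpre ; post-chain = cpost
    ; pre-ok = All.zipWith (λ { ((one-or-z , ne) , p≺) → one-unless-z one-or-z (≺⇒≢ (All.head p≺)) , ne })
                           (pre-ok , pre≺)
    ; post-ok = All.zipWith (λ { ((one-or-z , ne) , z≺p) → one-unless-z one-or-z (≺⇒≢ z≺p ∘ sym) , ne })
                            (post-ok , z≺post)
    ; pre≺z = All.map All.head pre≺ ; z≺post = z≺post
    ; length-pre-post = trans (sym (length-++ pre)) |ch| })

  lead : ℕ → ℕ
  lead r = firstTrue (E r) n

  -- If (i, j) lay on the chain of a copy, its corner would be south-west of (i, j − 1) and
  -- would inherit the chain north-east of that cell.
  zeros-up-to⇒NEChain : ∀ i j → i < m → j < n → (∀ j′ → j′ ≤ j → Zero (i , j′)) → NEChain (i , j)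
  zeros-up-to⇒NEChain i j i<m j<n zeros with zero-role (i , j) i<m j<n (zeros j ≤-refl)
  ... | inj₁ chain = chain
  zeros-up-to⇒NEChain i zero i<m j<n zeros | inj₂ t = ⊥-elim (n≮0 (proj₂ (ChainThrough.z-NE t)))
  zeros-up-to⇒NEChain i (suc j) i<m j<n zeros | inj₂ t =
    ⊥-elim (NEChain-at-one corner-one (NEChain-mono (<⇒≤ i<b) (s≤s⁻¹ b<j) chain))
    where
    open ChainThrough t
    i<b = proj₁ z-NE
    b<j = proj₂ z-NE
    chain = zeros-up-to⇒NEChain i j i<m (<-trans (n<1+n j) j<n) (λ j′ j′≤j → zeros j′ (m≤n⇒m≤1+n j′≤j))

  left-of-lead⇒NEChain : ∀ {r j} → r < m → j < lead r → NEChain (r , j)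
  left-of-lead⇒NEChain {r} {j} r<m j<lead =
    zeros-up-to⇒NEChain r j r<m (<-≤-trans j<lead (firstTrue-≤ (E r) n))
      (λ j′ j′≤j → <firstTrue⇒false (E r) n j′ (≤-<-trans j′≤j j<lead))

  1+[n∸1]≡n : suc (n ∸ 1) ≡ n
  1+[n∸1]≡n = m+[n∸m]≡n (≤-trans 1≤K (<⇒≤ K<n))

  lead<n : ∀ {r} → r < m → lead r < n
  lead<n {r} r<m with lead r <? n
  ... | yes lead<n = lead<n
  ... | no lead≮n with NEChain-witness (left-of-lead⇒NEChain r<m (<-≤-trans (≤-reflexive 1+[n∸1]≡n) (≮⇒≥ lead≮n)))
  ...   | p , p-one , _ , n∸1<p = ⊥-elim (<⇒≱ (proj₂ (bounded p-one)) (subst (_≤ col p) 1+[n∸1]≡n n∸1<p))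

  lead-one : ∀ {r} → r < m → One (r , lead r)
  lead-one {r} r<m = firstTrue-true (E r) n (lead<n r<m)

  lead-≤-below : ∀ {r b} → One b → r ≤ row b → lead r ≤ col b
  lead-≤-below {r} {b} b-one r≤b with lead r ≤? col b
  ... | yes lead≤b = lead≤b
  ... | no lead≰b = ⊥-elim (NEChain-at-one b-one
          (NEChain-mono r≤b ≤-refl (left-of-lead⇒NEChain (≤-<-trans r≤b (proj₁ (bounded b-one))) (≰⇒> lead≰b))))

  lead-mono : ∀ {r} → suc r < m → lead r ≤ lead (suc r)
  lead-mono {r} 1+r<m = lead-≤-below (lead-one 1+r<m) (n≤1+n r)

  lead-zero : 0 < m → lead 0 ≡ 0
  lead-zero 0<m with lead 0 in lead≡
  ... | zero = refl
  ... | suc _ with NEChain-witness (left-of-lead⇒NEChain 0<m (subst (0 <_) (sym lead≡) z<s))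
  ...   | _ , _ , () , _

  beyond-lead⇒ChainThrough : ∀ {r j} → r < m → lead r ≤ j → j < n → Zero (r , j) → ChainThrough (r , j)
  beyond-lead⇒ChainThrough {r} {j} r<m lead≤j j<n rj-zero with zero-role (r , j) r<m j<n rj-zero
  ... | inj₁ chain = ⊥-elim (NEChain-at-one (lead-one r<m) (NEChain-mono ≤-refl lead≤j chain))
  ... | inj₂ t = t

  between-leads-one : ∀ {r j} → suc r < m → lead r ≤ j → j < lead (suc r) → One (r , j)
  between-leads-one {r} {j} 1+r<m lead≤j j<lead′ with E r j in e
  ... | true = refl
  ... | false = ⊥-elim (NEChain-at-one corner-one
          (NEChain-mono (proj₁ z-NE) (<⇒≤ (proj₂ z-NE)) (left-of-lead⇒NEChain 1+r<m j<lead′)))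
    where open ChainThrough (beyond-lead⇒ChainThrough (<-trans (n<1+n r) 1+r<m) lead≤j
                               (<-≤-trans j<lead′ (firstTrue-≤ (E (suc r)) n)) e)

  last-row-one : ∀ {r j} → suc r ≡ m → lead r ≤ j → j < n → One (r , j)
  last-row-one {r} {j} refl lead≤j j<n with E r j in e
  ... | true = refl
  ... | false = ⊥-elim (<⇒≱ (proj₁ (bounded corner-one)) (proj₁ z-NE))
    where open ChainThrough (beyond-lead⇒ChainThrough ≤-refl lead≤j j<n e)

  entry : ℕ → ℕ → ℕ
  entry r j = if E r j then 1 else 0

  ones : ℕ → ℕ → ℕ → ℕ
  ones r = sumFrom (entry r)

  ones-full : ∀ r a d → (∀ j → a ≤ j → j < a + d → One (r , j)) → ones r a d ≡ d
  ones-full r a d one = sumFrom-const₁ _ a d (λ j a≤j j< → cong (λ e → if e then 1 else 0) (one j a≤j j<))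

  module UpperRow (i : ℕ) (1+i<m : suc i < m) where

    i<m : i < m
    i<m = <-trans (n<1+n i) 1+i<m

    c : ℕ
    c = lead (suc i)

    Box : ℕ → ℕ → Point → Set
    Box lo hi p = row p < i × lo < col p × col p < hi

    c-one : One (i , c)
    c-one with E i c in e
    ... | true = refl
    ... | false = ⊥-elim (<⇒≱ (proj₂ z-NE) (lead-≤-below corner-one (proj₁ z-NE)))
      where open ChainThrough (beyond-lead⇒ChainThrough i<m (lead-mono 1+i<m) (lead<n 1+i<m) e)

    module ZeroAt (x : ℕ) (c≤x : c ≤ x) (x<n : x < n) (x-zero : Zero (i , x)) where
      open ChainThrough (beyond-lead⇒ChainThrough i<m (≤-trans (lead-mono 1+i<m) c≤x) x<n x-zero)

      b : ℕ
      b = col corner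

      c≤b : c ≤ b
      c≤b = lead-≤-below corner-one (proj₁ z-NE)

      b<x : b < x
      b<x = proj₂ z-NE

      pre-is-longest : ∀ {X} → Chain X → All (One ∩ Box b (suc x)) X → length X ≤ length pre
      pre-is-longest {X} cX X-ok with length X ≤? length pre
      ... | yes short = short
      ... | no long = ⊥-elim (NEChain-at-one corner-one (X ++ post , chain , ++⁺ X-NE post-ok , K≤))
        where
        chain : Chain (X ++ post)
        chain = chain-++-via (i , suc x) cX post-chain
                  (All.map (λ { (_ , r< , _ , c<) → r< , c< }) X-ok)
                  (All.map (λ { (r< , c<) → <⇒≤ r< , c< }) z≺post)
        X-NE : All (One ∩ NE corner) X
        X-NE = All.map (λ { (one , r< , b< , _) → one , <-trans r< (proj₁ z-NE) , b< }) X-ok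
        K≤ : K ≤ length (X ++ post)
        K≤ = begin
          K                              ≡⟨ sym length-pre-post ⟩
          length pre + suc (length post) ≡⟨ +-suc (length pre) (length post) ⟩
          suc (length pre) + length post ≤⟨ +-monoˡ-≤ (length post) (≰⇒> long) ⟩
          length X + length post         ≡⟨ sym (length-++ X) ⟩
          length (X ++ post)             ∎
          where open ≤-Reasoning

      InPre : List Point → Set
      InPre l = Chain l × All (One ∩ Box b (suc x)) l × All (λ p → col p < x) l

      pre-facts : InPre pre
      pre-facts = pre-chain ,
        All.zipWith (λ { ((one , _ , b<) , (r< , c<)) → one , r< , b< , m<n⇒m<1+n c< }) (pre-ok , pre≺z) ,
        All.map proj₂ pre≺z

      suffix-of-pre : ∀ C′ {C} → pre ≡ C′ ++ C → InPre C
      suffix-of-pre C′ pre≡ with subst InPre pre≡ pre-facts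
      ... | cpre , box , <x = proj₁ (proj₂ (chain-++⁻ C′ cpre)) , ++⁻ʳ C′ box , ++⁻ʳ C′ <x

      no-branch-off-pre : ∀ C′ {c₀ C X} → pre ≡ C′ ++ c₀ ∷ C → Chain (c₀ ∷ X) →
        All (One ∩ Box b (suc x)) X → length X ≤ length C
      no-branch-off-pre C′ {c₀} {C} {X} pre≡ c₀X X-box with subst InPre pre≡ pre-facts
      ... | cpre , box , _ with chain-++⁻ C′ cpre | ++⁻ˡ C′ box | ++⁻ʳ C′ box
      ...   | cC′ , _ , C′≺C | C′-box | c₀-box ∷ _ = +-cancelˡ-≤ (length C′) (length X) (length C) (s≤s⁻¹ (begin
          suc (length C′ + length X)   ≡⟨ +-suc (length C′) (length X) ⟨
          length C′ + length (c₀ ∷ X)  ≡⟨ length-++ C′ ⟨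
          length (C′ ++ c₀ ∷ X)        ≤⟨ pre-is-longest chain (++⁺ C′-box (c₀-box ∷ X-box)) ⟩
          length pre                   ≡⟨ trans (cong length pre≡) (length-++ C′) ⟩
          length C′ + length (c₀ ∷ C)  ≡⟨ +-suc (length C′) (length C) ⟩
          suc (length C′ + length C)   ∎))
        where
        open ≤-Reasoning
        chain : Chain (C′ ++ c₀ ∷ X)
        chain = chain-++-via c₀ cC′ c₀X (All.map All.head C′≺C) (≼-refl ∷ All.map ≺⇒≼ (AllPairs.head c₀X))

      left-of-b : ∀ {Q} → All (One ∩ Box c (suc x)) Q → All (λ p → col p ≤ b) Q → All (One ∩ Box c x) Q
      left-of-b Q-ok Q≤b =
        All.zipWith (λ { ((one , r< , c< , _) , q≤b) → one , r< , c< , ≤-<-trans q≤b b<x }) (Q-ok , Q≤b)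

      -- A chain Q ++ S reaching column x is shortened to avoid it: its part S right of column b
      -- is crossed with an equally long final segment of pre.
      cross : ∀ {Q} S → Chain (Q ++ S) → All (One ∩ Box c (suc x)) Q → All (λ p → col p ≤ b) Q →
        All (One ∩ Box b (suc x)) S → Any (λ p → x ≤ col p) S →
        Σ (List Point) λ P′ → Chain P′ × All (One ∩ Box c x) P′ × length (Q ++ S) ≤ length P′
      cross {Q} (s ∷ S) cP Q-ok Q≤b sS-box x≤sS with chain-++⁻ Q cP
      ... | cQ , csS , Q≺sS with split-suffix (length (s ∷ S)) pre (pre-is-longest csS sS-box)
      ... | C′ , c₀ ∷ C , pre≡ , |C| with suffix-of-pre C′ pre≡
      ... | cC , C-box , C<x
        with exchange (frontier Q) s c₀ S C (sym (suc-injective |C|)) csS cC sS-box C-box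
               (frontier-row-≤ (All.map (proj₁ ∘ All.head) Q≺sS) , frontier-col-≤ (All.map (proj₂ ∘ All.head) Q≺sS))
               (frontier-col-≤ (All.map (λ q≤b → ≤-<-trans q≤b (proj₁ (proj₂ (proj₂ (All.head C-box))))) Q≤b))
               C<x x≤sS
      ... | inj₁ (R , cR , R-box , π≼R , R<x , |R|) =
        Q ++ R , chain-++-via (frontier Q) cQ cR (≺-frontier Q) π≼R ,
        ++⁺ (left-of-b Q-ok Q≤b)
            (All.zipWith (λ { ((one , r< , b< , _) , r<x) → one , r< , ≤-<-trans c≤b b< , r<x }) (R-box , R<x)) ,
        ≤-reflexive (trans (length-++ Q) (trans (cong (length Q +_) (sym |R|)) (sym (length-++ Q))))
      ... | inj₂ (X , c₀X , X-box , |X|) =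
        ⊥-elim (<⇒≱ (≤-reflexive (trans |C| (sym |X|)))
                    (no-branch-off-pre C′ pre≡ c₀X X-box))

      reroute : ∀ {P} → Chain P → All (One ∩ Box c (suc x)) P →
        Σ (List Point) λ P′ → Chain P′ × All (One ∩ Box c x) P′ × length P ≤ length P′
      reroute cP P-ok with split-at-column b cP
      ... | Q , S , refl , Q≤b , b<S with ++⁻ˡ Q P-ok | ++⁻ʳ Q P-ok | All.all? (λ p → col p <? x) S
      ... | Q-ok | S-ok | yes S<x =
        Q ++ S , cP ,
        ++⁺ (left-of-b Q-ok Q≤b) (All.zipWith (λ { ((one , r< , c< , _) , s<x) → one , r< , c< , s<x }) (S-ok , S<x)) ,
        ≤-refl
      ... | Q-ok | S-ok | no S≮x =
        cross S cP Q-ok Q≤b (All.zipWith (λ { ((one , r< , _ , <1+x) , b<) → one , r< , b< , <1+x }) (S-ok , b<S))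
              (Any.map ≮⇒≥ (¬All⇒Any¬ (λ p → col p <? x) S S≮x))

    avoid-column : ∀ x → c ≤ x → x < n → ∀ {P} → Chain P → All (One ∩ Box c (suc x)) P →
      Σ (List Point) λ P′ → Chain P′ × All (One ∩ Box c x) P′ ×
                            length P ≤ length P′ + entry i x
    avoid-column x c≤x x<n {P} cP P-ok with E i x in e
    ... | false with ZeroAt.reroute x c≤x x<n e cP P-ok
    ...   | P′ , cP′ , P′-ok , |P|≤|P′| = P′ , cP′ , P′-ok , ≤-trans |P|≤|P′| (m≤m+n _ 0)
    avoid-column x c≤x x<n {P} cP P-ok | true with initLast P
    ... | [] = [] , [] , [] , z≤n
    ... | P₀ ∷ʳ′ y with chain-++⁻ P₀ cP
    ...   | cP₀ , _ , P₀≺y =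
      P₀ , cP₀ , All.zipWith (λ { ((one , r< , c< , _) , p≺y) → one , r< , c< , <-≤-trans (proj₂ (All.head p≺y)) y≤x })
                             (++⁻ˡ P₀ P-ok , P₀≺y) ,
      ≤-reflexive (length-++ P₀)
      where
      y≤x : col y ≤ x
      y≤x = s≤s⁻¹ (proj₂ (proj₂ (proj₂ (All.head (++⁻ʳ P₀ P-ok)))))

    chain-length<ones : ∀ d → c + d < n → ∀ {P} → Chain P → All (One ∩ Box c (suc (c + d))) P →
      length P < ones i c (suc d)
    chain-length<ones zero _ {[]} _ _ = subst (0 <_) (cong (λ e → (if e then 1 else 0) + 0) (sym c-one)) (z<s {0})
    chain-length<ones zero _ {p ∷ _} _ ((_ , _ , c<p , p<1+c+0) ∷ _) =
      ⊥-elim (<⇒≱ c<p (subst (col p ≤_) (+-identityʳ c) (s≤s⁻¹ p<1+c+0)))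
    chain-length<ones (suc d) c+1+d<n {P} cP P-ok
      with avoid-column (c + suc d) (m≤m+n c (suc d)) c+1+d<n cP P-ok
    ... | P′ , cP′ , P′-ok , |P|≤ = begin-strict
      length P                                ≤⟨ |P|≤ ⟩
      length P′ + column-x
        <⟨ +-monoˡ-< column-x (chain-length<ones d c+d<n cP′ (All.map shift P′-ok)) ⟩
      ones i c (suc d) + column-x             ≡⟨ sym (sumFrom-snoc (entry i) c (suc d)) ⟩
      ones i c (suc (suc d))                  ∎
      where
      open ≤-Reasoning
      column-x = entry i (c + suc d)
      c+d<n : c + d < n
      c+d<n = ≤-<-trans (+-monoʳ-≤ c (n≤1+n d)) c+1+d<n
      shift : ∀ {p} → (One ∩ Box c (c + suc d)) p → (One ∩ Box c (suc (c + d))) p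
      shift {p} = subst (λ hi → (One ∩ Box c hi) p) (+-suc c d)

    c≤n : c ≤ n
    c≤n = <⇒≤ (lead<n 1+i<m)

    K≤n∸c : K ≤ n ∸ c
    K≤n∸c with lead (suc i) in c≡
    ... | zero = <⇒≤ K<n
    ... | suc c′ with left-of-lead⇒NEChain {j = c′} 1+i<m (≤-reflexive (sym c≡))
    ...   | ch , cch , ok , K≤ =
      ≤-trans K≤ (chain-length-≤-columns (suc c′) n cch
                   (All.map (λ { (one , _ , c′<) → c′< , proj₂ (bounded one) }) ok))

    K≤ones-around-last-zero : ∀ {x} → c < x → x < n → Zero (i , x) → (∀ j → x < j → j < n → One (i , j)) →
      K ≤ ones i c (n ∸ c)
    K≤ones-around-last-zero {x} c<x x<n x-zero after with m≤n⇒∃[o]m+o≡n c<x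
    ... | o , refl = begin
      K                                 ≡⟨ sym length-pre-post ⟩
      length pre + suc (length post)    ≡⟨ +-suc (length pre) (length post) ⟩
      suc (length pre) + length post    ≤⟨ +-mono-≤ pre-count post-count ⟩
      ones i c (suc o) + e
        ≡⟨ cong₂ (λ u v → ones i c (suc o) + (u + v)) (cong (λ b → if b then 1 else 0) x-zero) right-of-x ⟨
      ones i c (suc o) + ones i x (suc e) ≡⟨ cong₂ _+_ (cong (ones i c) x∸c≡) (cong (ones i x) n∸x≡) ⟨
      ones i c (x ∸ c) + ones i x (n ∸ x) ≡⟨ sumFrom-split (entry i) (<⇒≤ c<x) (<⇒≤ x<n) ⟨
      ones i c (n ∸ c)                  ∎
      where
      open ≤-Reasoning
      open ChainThrough (beyond-lead⇒ChainThrough i<m (≤-trans (lead-mono 1+i<m) (<⇒≤ c<x)) x<n x-zero)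
      e = n ∸ suc x
      c≤b : c ≤ col corner
      c≤b = lead-≤-below corner-one (proj₁ z-NE)
      pre-count : length pre < ones i c (suc o)
      pre-count = chain-length<ones o (<-trans (n<1+n (c + o)) x<n) pre-chain
        (All.zipWith (λ { ((one , _ , b<) , (r< , c<)) → one , r< , ≤-<-trans c≤b b< , c< }) (pre-ok , pre≺z))
      post-count : length post ≤ e
      post-count = chain-length-≤-columns (suc x) n post-chain
        (All.zipWith (λ { ((one , _) , (_ , x<)) → x< , proj₂ (bounded one) }) (post-ok , z≺post))
      right-of-x : ones i (suc x) e ≡ e
      right-of-x = ones-full i (suc x) e (λ j x<j j< → after j x<j (subst (j <_) (m+[n∸m]≡n x<n) j<))
      x∸c≡ : x ∸ c ≡ suc o
      x∸c≡ = trans (+-∸-assoc 1 (m≤m+n c o)) (cong suc (m+n∸m≡n c o))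
      n∸x≡ : n ∸ x ≡ suc e
      n∸x≡ = +-∸-assoc 1 x<n

    K≤ones-right-of-c : K ≤ ones i c (n ∸ c)
    K≤ones-right-of-c with lastFalse (E i) c n
    ... | inj₁ all-one =
      subst (K ≤_) (sym (ones-full i c (n ∸ c) (λ j c≤j j< → all-one j c≤j (subst (j <_) (m+[n∸m]≡n c≤n) j<))))
            K≤n∸c
    ... | inj₂ (x , c≤x , x<n , x-zero , after) =
      K≤ones-around-last-zero (≤∧≢⇒< c≤x λ { refl → one-not-zero c-one x-zero }) x<n x-zero after

  row-ones : ∀ {i} → suc i < m → lead (suc i) + K ≤ ones i 0 n + lead i
  row-ones {i} 1+i<m = begin
    b + K                                     ≡⟨ cong (_+ K) (m∸n+n≡m a≤b) ⟨
    (b ∸ a) + a + K                           ≡⟨ +-CS.xy∙z≈xz∙y (b ∸ a) a K ⟩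
    (b ∸ a) + K + a                           ≤⟨ +-monoˡ-≤ a (+-mono-≤ (≤-reflexive (sym between)) K≤ones-right-of-c) ⟩
    ones i a (b ∸ a) + ones i b (n ∸ b) + a   ≡⟨ cong (_+ a) (sumFrom-split (entry i) a≤b b≤n) ⟨
    ones i a (n ∸ a) + a                      ≤⟨ +-monoˡ-≤ a (sumFrom-suffix-≤ (entry i) (≤-trans a≤b b≤n)) ⟩
    ones i 0 n + a                            ∎
    where
    open ≤-Reasoning
    open UpperRow i 1+i<m using (K≤ones-right-of-c)
    a b : ℕ
    a = lead i
    b = lead (suc i)
    a≤b = lead-mono 1+i<m
    b≤n = <⇒≤ (lead<n 1+i<m)
    between : ones i a (b ∸ a) ≡ b ∸ a
    between = ones-full i a (b ∸ a) (λ j a≤j j< → between-leads-one 1+i<m a≤j (subst (j <_) (m+[n∸m]≡n a≤b) j<))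

  last-row-ones : ∀ {r} → suc r ≡ m → n ≤ ones r 0 n + lead r
  last-row-ones {r} 1+r≡m = begin
    n                       ≡⟨ m∸n+n≡m a≤n ⟨
    (n ∸ a) + a             ≡⟨ cong (_+ a) full ⟨
    ones r a (n ∸ a) + a    ≤⟨ +-monoˡ-≤ a (sumFrom-suffix-≤ (entry r) a≤n) ⟩
    ones r 0 n + a          ∎
    where
    open ≤-Reasoning
    a = lead r
    a≤n = <⇒≤ (lead<n (≤-reflexive 1+r≡m))
    full : ones r a (n ∸ a) ≡ n ∸ a
    full = ones-full r a (n ∸ a) (λ j a≤j j< → last-row-one 1+r≡m a≤j (subst (j <_) (m+[n∸m]≡n a≤n) j<))

  sum-of-rows-≥ : ∀ {m′} → suc m′ ≡ m → K * m′ + n ≤ sumFrom (λ r → ones r 0 n) 0 m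
  sum-of-rows-≥ {m′} refl = begin
    K * m′ + n                               ≤⟨ +-monoʳ-≤ (K * m′) (last-row-ones refl) ⟩
    K * m′ + (h m′ + lead m′)                ≡⟨ +-CS.x∙yz≈y∙zx (K * m′) (h m′) (lead m′) ⟩
    h m′ + (lead m′ + K * m′)
      ≤⟨ +-monoʳ-≤ (h m′) (telescope h lead K m′ (λ r r<m′ → row-ones (s≤s r<m′))) ⟩
    h m′ + (sumFrom h 0 m′ + lead 0)         ≡⟨ cong (λ l → h m′ + (sumFrom h 0 m′ + l)) (lead-zero z<s) ⟩
    h m′ + (sumFrom h 0 m′ + 0)              ≡⟨ trans (cong (h m′ +_) (+-identityʳ _)) (+-comm (h m′) _) ⟩
    sumFrom h 0 m′ + h m′                    ≡⟨ sym (sumFrom-snoc h 0 m′) ⟩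
    sumFrom h 0 (suc m′)                     ∎
    where
    open ≤-Reasoning
    h : ℕ → ℕ
    h r = ones r 0 n

J-true⁻ : ∀ k (a a′ : Fin k) → J k a a′ ≡ true →
  toℕ a′ ≡ suc (toℕ a) ⊎ (toℕ a ≡ k ∸ 1 × toℕ a′ ≡ 0)
J-true⁻ k a a′ J≡true with toℕ a′ ≟ suc (toℕ a) | toℕ a ≟ k ∸ 1 | toℕ a′ ≟ 0
... | yes super | _ | _ = inj₁ super
... | no _ | yes last | yes first = inj₂ (last , first)
... | no _ | yes _ | no _ with () ← J≡true
... | no _ | no _ | _ with () ← J≡true

J-super : ∀ k (a a′ : Fin k) → toℕ a′ ≡ suc (toℕ a) → J k a a′ ≡ true
J-super k a a′ super with toℕ a′ ≟ suc (toℕ a)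
... | yes _ = refl
... | no ¬super = ⊥-elim (¬super super)

J-corner : ∀ k (a a′ : Fin k) → toℕ a ≡ k ∸ 1 → toℕ a′ ≡ 0 → J k a a′ ≡ true
J-corner k a a′ last first with toℕ a′ ≟ suc (toℕ a) | toℕ a ≟ k ∸ 1 | toℕ a′ ≟ 0
... | yes _ | _ | _ = refl
... | no _ | yes _ | yes _ = refl
... | no _ | no ¬last | _ = ⊥-elim (¬last last)
... | no _ | yes _ | no ¬first = ⊥-elim (¬first first)

toGrid : ∀ {m n} → Matrix m n → ℕ → ℕ → Bool
toGrid {m} {n} M r c with r <? m | c <? n
... | yes r<m | yes c<n = M (fromℕ< r<m) (fromℕ< c<n)
... | _ | _ = false

toGrid-fromℕ< : ∀ {m n} (M : Matrix m n) {r c} (r<m : r < m) (c<n : c < n) →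
  toGrid M r c ≡ M (fromℕ< r<m) (fromℕ< c<n)
toGrid-fromℕ< {m} {n} M {r} {c} r<m c<n with r <? m | c <? n
... | yes _ | yes _ = refl
... | no r≮m | _ = ⊥-elim (r≮m r<m)
... | yes _ | no c≮n = ⊥-elim (c≮n c<n)

toGrid-toℕ : ∀ {m n} (M : Matrix m n) i j → toGrid M (toℕ i) (toℕ j) ≡ M i j
toGrid-toℕ M i j =
  trans (toGrid-fromℕ< M (toℕ<n i) (toℕ<n j)) (cong₂ M (fromℕ<-toℕ i (toℕ<n i)) (fromℕ<-toℕ j (toℕ<n j)))

toGrid-bounded : ∀ {m n} (M : Matrix m n) {p} → IsOne (toGrid M) p → row p < m × col p < n
toGrid-bounded {m} {n} M {r , c} one with r <? m | c <? n
... | yes r<m | yes c<n = r<m , c<n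
toGrid-bounded M () | yes _ | no _
toGrid-bounded M () | no _ | _

flipOn-true⁻ : ∀ {m n} (M : Matrix m n) i j i′ j′ → flipOn M i j i′ j′ ≡ true →
  (toℕ i ≡ toℕ i′ × toℕ j ≡ toℕ j′) ⊎ M i′ j′ ≡ true
flipOn-true⁻ M i j i′ j′ flip≡true with toℕ i ≟ toℕ i′ | toℕ j ≟ toℕ j′
... | yes i≡ | yes j≡ = inj₁ (i≡ , j≡)
... | yes _ | no _ = inj₂ flip≡true
... | no _ | _ = inj₂ flip≡true

occurrence-of-copy : ∀ {m n K} (X : Matrix m n) {U : Pred Point 0ℓ} →
  (∀ i j → X i j ≡ true → U (toℕ i , toℕ j)) → Contains X (J (suc K)) →
  Σ Point λ b → Σ (List Point) λ ch → Occurrence U K b ch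
occurrence-of-copy {K = K} X X⊆U (r , c , r-inc , c-inc , hit) =
  b , ch , X⊆U _ _ (hit (fromℕ K) fzero (J-corner (suc K) (fromℕ K) fzero (toℕ-fromℕ K) refl)) ,
  AllPairsₚ.tabulate⁺-< (λ a<a′ → r-inc _ _ (inject₁-< a<a′) , c-inc _ _ (s≤s a<a′)) ,
  tabulate⁺ (λ a → X⊆U _ _ (hit (inject₁ a) (fsuc a)
                                (J-super (suc K) (inject₁ a) (fsuc a) (cong suc (sym (toℕ-inject₁ a))))) ,
                  r-inc _ _ (subst₂ _<_ (sym (toℕ-inject₁ a)) (sym (toℕ-fromℕ K)) (toℕ<n a)) ,
                  c-inc _ _ z<s) ,
  length-tabulate _
  where
  b : Point
  b = toℕ (r (fromℕ K)) , toℕ (c fzero)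
  ch : List Point
  ch = tabulate λ a → toℕ (r (inject₁ a)) , toℕ (c (fsuc a))
  inject₁-< : ∀ {a a′ : Fin K} → toℕ a < toℕ a′ → toℕ (inject₁ a) < toℕ (inject₁ a′)
  inject₁-< {a} {a′} = subst₂ _<_ (sym (toℕ-inject₁ a)) (sym (toℕ-inject₁ a′))

at : Point → List Point → ℕ → Point
at d [] _ = d
at d (p ∷ ps) zero = p
at d (p ∷ ps) (suc a) = at d ps a

All-at : ∀ {U : Pred Point 0ℓ} {d xs} a → U d → All U xs → U (at d xs a)
All-at _ Ud [] = Ud
All-at zero Ud (Up ∷ _) = Up
All-at (suc a) Ud (_ ∷ Ups) = All-at a Ud Ups

All-at-< : ∀ {U : Pred Point 0ℓ} {d xs} a → a < length xs → All U xs → U (at d xs a)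
All-at-< zero _ (Up ∷ _) = Up
All-at-< (suc a) a< (_ ∷ Ups) = All-at-< a (s≤s⁻¹ a<) Ups

at-length : ∀ d xs → at d xs (length xs) ≡ d
at-length d [] = refl
at-length d (p ∷ ps) = at-length d ps

at-increasing : ∀ {R : Point → Point → Set} {d xs} a a′ → AllPairs R xs → a < a′ → a′ < length xs →
  R (at d xs a) (at d xs a′)
at-increasing zero (suc a′) (p≺ ∷ _) _ a′< = All-at-< a′ (s≤s⁻¹ a′<) p≺
at-increasing (suc a) (suc a′) (_ ∷ rxs) a<a′ a′< = at-increasing a a′ rxs (s≤s⁻¹ a<a′) (s≤s⁻¹ a′<)

at-increasing-to : ∀ {R : Point → Point → Set} {d xs} a a′ → AllPairs R xs → All (λ x → R x d) xs →
  a < a′ → a < length xs → R (at d xs a) (at d xs a′)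
at-increasing-to zero (suc a′) (p≺ ∷ _) (p≺d ∷ _) _ _ = All-at a′ p≺d p≺
at-increasing-to (suc a) (suc a′) (_ ∷ rxs) (_ ∷ xs≺d) a<a′ a< =
  at-increasing-to a a′ rxs xs≺d (s≤s⁻¹ a<a′) (s≤s⁻¹ a<)

copy-of-occurrence : ∀ {m n K} (M : Matrix m n) {b ch} → Occurrence (IsOne (toGrid M)) K b ch →
  Contains M (J (suc K))
copy-of-occurrence M {b} {ch} (b-one , cch , ok , refl) = r , c , r-inc , c-inc , hit
  where
  One = IsOne (toGrid M)
  ones : All One ch
  ones = All.map proj₁ ok
  rowAt colAt : ℕ → ℕ
  rowAt a = row (at b ch a)
  colAt a = col (at b (b ∷ ch) a)
  rowAt<m : ∀ a → rowAt a < _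
  rowAt<m a = proj₁ (toGrid-bounded M (All-at a b-one ones))
  colAt<n : ∀ a → colAt a < _
  colAt<n a = proj₂ (toGrid-bounded M (All-at a b-one (b-one ∷ ones)))
  r : Fin (suc (length ch)) → Fin _
  r a = fromℕ< (rowAt<m (toℕ a))
  c : Fin (suc (length ch)) → Fin _
  c a = fromℕ< (colAt<n (toℕ a))
  r-inc : Increasing r
  r-inc a a′ a<a′ = subst₂ _<_ (sym (toℕ-fromℕ< _)) (sym (toℕ-fromℕ< _))
    (at-increasing-to (toℕ a) (toℕ a′) (AllPairs.map proj₁ cch) (All.map (proj₁ ∘ proj₂) ok)
                      a<a′ (<-≤-trans a<a′ (s≤s⁻¹ (toℕ<n a′))))
  c-inc : Increasing c
  c-inc a a′ a<a′ = subst₂ _<_ (sym (toℕ-fromℕ< _)) (sym (toℕ-fromℕ< _))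
    (at-increasing (toℕ a) (toℕ a′) (All.map (proj₂ ∘ proj₂) ok ∷ AllPairs.map proj₂ cch) a<a′ (toℕ<n a′))
  hit-at : ∀ a a′ → One (rowAt (toℕ a) , colAt (toℕ a′)) → M (r a) (c a′) ≡ true
  hit-at a a′ one = trans (sym (toGrid-fromℕ< M (rowAt<m (toℕ a)) (colAt<n (toℕ a′)))) one
  hit : ∀ a a′ → J (suc (length ch)) a a′ ≡ true → M (r a) (c a′) ≡ true
  hit a a′ J≡true with J-true⁻ _ a a′ J≡true
  ... | inj₁ super = hit-at a a′ (subst (λ t → One (rowAt (toℕ a) , colAt t)) (sym super) (All-at (toℕ a) b-one ones))
  ... | inj₂ (last , first) =
    hit-at a a′ (subst₂ (λ s t → One (row (at b ch s) , colAt t)) (sym last) (sym first)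
                        (subst (λ p → One (row p , col b)) (sym (at-length b ch)) b-one))

saturating-weight-≥ : ∀ {K m n} → 1 ≤ K → K < n → (M : Matrix (suc m) n) → Saturating M (J (suc K)) →
  K * m + n ≤ weight M
saturating-weight-≥ {K} {m} {n} 1≤K K<n M (avoids , saturates) =
  subst (K * m + n ≤_) (sym weight≡) (sum-of-rows-≥ refl)
  where
  One = IsOne (toGrid M)
  copy-after-flip : ∀ z → row z < suc m → col z < n → toGrid M (row z) (col z) ≡ false →
    Σ Point λ b → Σ (List Point) λ ch → Occurrence (One ∪ (_≡ z)) K b ch
  copy-after-flip (r , c) r<m c<n rc-zero =
    occurrence-of-copy (flipOn M i j) flipped-one (saturates i j (trans (sym (toGrid-fromℕ< M r<m c<n)) rc-zero))
    where
    i = fromℕ< r<m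
    j = fromℕ< c<n
    flipped-one : ∀ i′ j′ → flipOn M i j i′ j′ ≡ true → (One ∪ (_≡ (r , c))) (toℕ i′ , toℕ j′)
    flipped-one i′ j′ flip≡true with flipOn-true⁻ M i j i′ j′ flip≡true
    ... | inj₁ (i≡ , j≡) = inj₂ (cong₂ _,_ (trans (sym i≡) (toℕ-fromℕ< r<m)) (trans (sym j≡) (toℕ-fromℕ< c<n)))
    ... | inj₂ M≡true = inj₁ (trans (toGrid-toℕ M i′ j′) M≡true)
  open Saturated (suc m) n K (toGrid M) 1≤K K<n (toGrid-bounded M) (avoids ∘ copy-of-occurrence M) copy-after-flip
  weight≡ : weight M ≡ sumFrom (λ r → ones r 0 n) 0 (suc m)
  weight≡ = sum-tabulate _ 0 (suc m) _ λ i →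
    sum-tabulate (entry (toℕ i)) 0 n _ λ j → cong (λ e → if e then 1 else 0) (sym (toGrid-toℕ M i j))

antiTranspose : ∀ {m n} → Matrix m n → Matrix n m
antiTranspose M i j = M (opposite j) (opposite i)

opposite-< : ∀ {k} (a a′ : Fin k) → toℕ a < toℕ a′ → toℕ (opposite a′) < toℕ (opposite a)
opposite-< {k} a a′ a<a′ =
  subst₂ _<_ (sym (opposite-prop a′)) (sym (opposite-prop a)) (∸-monoʳ-< {k} (s≤s a<a′) (toℕ<n a′))

J-antiTranspose : ∀ k (a a′ : Fin k) → J k a a′ ≡ true → J k (opposite a′) (opposite a) ≡ true
J-antiTranspose (suc k) a a′ J≡true with J-true⁻ (suc k) a a′ J≡true
... | inj₁ super = J-super (suc k) (opposite a′) (opposite a) (begin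
  toℕ (opposite a)              ≡⟨ opposite-prop a ⟩
  suc k ∸ suc (toℕ a)           ≡⟨ cong (suc k ∸_) super ⟨
  suc (suc k) ∸ suc (toℕ a′)    ≡⟨ +-∸-assoc 1 (toℕ<n a′) ⟩
  suc (suc k ∸ suc (toℕ a′))    ≡⟨ cong suc (opposite-prop a′) ⟨
  suc (toℕ (opposite a′))       ∎)
  where open ≡-Reasoning
... | inj₂ (last , first) = J-corner (suc k) (opposite a′) (opposite a)
  (trans (opposite-prop a′) (cong (λ t → suc k ∸ suc t) first))
  (trans (opposite-prop a) (trans (cong (λ t → suc k ∸ suc t) last) (n∸n≡0 k)))

contains-mono : ∀ {m n k l} {X Y : Matrix m n} {P : Matrix k l} →
  (∀ i j → X i j ≡ true → Y i j ≡ true) → Contains X P → Contains Y P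
contains-mono X⊆Y (r , c , r-inc , c-inc , hit) = r , c , r-inc , c-inc , λ a a′ → X⊆Y _ _ ∘ hit a a′

contains-antiTranspose : ∀ {m n k} (X : Matrix m n) → Contains X (J k) → Contains (antiTranspose X) (J k)
contains-antiTranspose X (r , c , r-inc , c-inc , hit) = r′ , c′ , r′-inc , c′-inc , hit′
  where
  r′ = opposite ∘ c ∘ opposite
  c′ = opposite ∘ r ∘ opposite
  r′-inc : Increasing r′
  r′-inc a a′ a<a′ = opposite-< _ _ (c-inc _ _ (opposite-< a a′ a<a′))
  c′-inc : Increasing c′
  c′-inc a a′ a<a′ = opposite-< _ _ (r-inc _ _ (opposite-< a a′ a<a′))
  hit′ : ∀ a a′ → J _ a a′ ≡ true → antiTranspose X (r′ a) (c′ a′) ≡ true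
  hit′ a a′ J≡true rewrite opposite-involutive (r (opposite a′)) | opposite-involutive (c (opposite a)) =
    hit (opposite a′) (opposite a) (J-antiTranspose _ a a′ J≡true)

toℕ-opposite-injective : ∀ {k} {a a′ : Fin k} → toℕ (opposite a) ≡ toℕ (opposite a′) → toℕ a ≡ toℕ a′
toℕ-opposite-injective {a = a} {a′} e =
  cong toℕ (trans (sym (opposite-involutive a)) (trans (cong opposite (toℕ-injective e)) (opposite-involutive a′)))

saturating-antiTranspose : ∀ {m n k} (M : Matrix m n) → Saturating M (J k) → Saturating (antiTranspose M) (J k)
saturating-antiTranspose M (avoids , saturates) = avoids′ , saturates′
  where
  avoids′ : Avoids (antiTranspose M) (J _)
  avoids′ = avoids
    ∘ contains-mono (λ i j → subst₂ (λ i′ j′ → M i′ j′ ≡ true) (opposite-involutive i) (opposite-involutive j))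
    ∘ contains-antiTranspose (antiTranspose M)
  saturates′ : ∀ i j → antiTranspose M i j ≡ false → Contains (flipOn (antiTranspose M) i j) (J _)
  saturates′ i j M≡false =
    contains-mono flipped
      (contains-antiTranspose (flipOn M (opposite j) (opposite i)) (saturates (opposite j) (opposite i) M≡false))
    where
    flipped : ∀ a b → antiTranspose (flipOn M (opposite j) (opposite i)) a b ≡ true →
      flipOn (antiTranspose M) i j a b ≡ true
    flipped a b flip≡true with flipOn-true⁻ M (opposite j) (opposite i) (opposite b) (opposite a) flip≡true
    ... | inj₂ M≡true = trans (cong (_ ∨_) M≡true) (∨-zeroʳ _)
    ... | inj₁ (j≡ , i≡) with toℕ i ≟ toℕ a | toℕ j ≟ toℕ b
    ...   | yes _ | yes _ = refl
    ...   | no i≢ | _ = ⊥-elim (i≢ (toℕ-opposite-injective i≡))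
    ...   | yes _ | no j≢ = ⊥-elim (j≢ (toℕ-opposite-injective j≡))

sum-tabulate≡∑ : ∀ {d} (f : Fin d → ℕ) → sum (tabulate f) ≡ ∑.sum f
sum-tabulate≡∑ {zero} f = refl
sum-tabulate≡∑ {suc d} f = cong (f fzero +_) (sum-tabulate≡∑ (f ∘ fsuc))

weight-antiTranspose : ∀ {m n} (M : Matrix m n) → weight (antiTranspose M) ≡ weight M
weight-antiTranspose {m} {n} M = begin
  weight (antiTranspose M)                                  ≡⟨ weight≡∑ (antiTranspose M) ⟩
  ∑.sum (λ i → ∑.sum (λ j → count (M (opposite j) (opposite i))))
    ≡⟨ ∑.sum-cong-≗ (λ i → ∑.∑-permute (λ j → count (M j (opposite i))) Perm.reverse) ⟨
  ∑.sum (λ i → ∑.sum (λ j → count (M j (opposite i))))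
    ≡⟨ ∑.∑-permute (λ i → ∑.sum (λ j → count (M j i))) Perm.reverse ⟨
  ∑.sum (λ i → ∑.sum (λ j → count (M j i)))      ≡⟨ ∑.∑-comm (λ i j → count (M j i)) ⟩
  ∑.sum (λ j → ∑.sum (λ i → count (M j i)))      ≡⟨ weight≡∑ M ⟨
  weight M                                        ∎
  where
  open ≡-Reasoning
  count : Bool → ℕ
  count b = if b then 1 else 0
  weight≡∑ : ∀ {m n} (X : Matrix m n) → weight X ≡ ∑.sum (λ i → ∑.sum (λ j → count (X i j)))
  weight≡∑ X = trans (cong sum (tabulate-cong (λ i → sum-tabulate≡∑ (λ j → count (X i j)))))
                     (sum-tabulate≡∑ (λ i → ∑.sum (λ j → count (X i j))))

saturating-weight-≥′ : ∀ {K m n} → 1 ≤ K → K < m → (M : Matrix m (suc n)) → Saturating M (J (suc K)) →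
  K * n + m ≤ weight M
saturating-weight-≥′ 1≤K K<m M saturating =
  subst (_ ≤_) (weight-antiTranspose M)
    (saturating-weight-≥ 1≤K K<m (antiTranspose M) (saturating-antiTranspose M saturating))

2a≤a[1+a] : ∀ a → 2 * a ≤ a * suc a
2a≤a[1+a] zero = z≤n
2a≤a[1+a] (suc b) =
  subst (2 * suc b ≤_) (*-comm (suc (suc b)) (suc b)) (*-monoˡ-≤ (suc b) {2} {suc (suc b)} (s≤s (s≤s z≤n)))

weight-bound⇒theorem-bound : ∀ a p q w → suc a * p + q ≤ w →
  2 * (a * suc p + suc p + q ∸ 1) ≤ 2 * w + a * suc a
weight-bound⇒theorem-bound a p q w bound = begin
  2 * (a * suc p + suc p + q ∸ 1)   ≡⟨ cong (λ t → 2 * (t + q ∸ 1)) (+-suc (a * suc p) p) ⟩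
  2 * (a * suc p + p + q)           ≡⟨ cong (2 *_) (rearrange a p q) ⟩
  2 * (suc a * p + q + a)           ≡⟨ *-distribˡ-+ 2 (suc a * p + q) a ⟩
  2 * (suc a * p + q) + 2 * a       ≤⟨ +-mono-≤ (*-monoʳ-≤ 2 bound) (2a≤a[1+a] a) ⟩
  2 * w + a * suc a                 ∎
  where
  open ≤-Reasoning
  rearrange : ∀ a p q → a * suc p + p + q ≡ suc a * p + q + a
  rearrange = solve-∀

theorem6 : (k m n : ℕ) → 2 ≤ k → k ≤ m → k ≤ n →
    (M : Matrix m n) → Saturating M (J k) →
    2 * ((k ∸ 2) * (m ⊔ n) + m + n ∸ 1) ≤ 2 * weight M + (k ∸ 2) * (k ∸ 1)
theorem6 (suc (suc a)) (suc m) (suc n) _ k≤m k≤n M saturating with ≤-total (suc n) (suc m)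
... | inj₁ n≤m rewrite m≥n⇒m⊔n≡m n≤m =
  weight-bound⇒theorem-bound a m (suc n) (weight M) (saturating-weight-≥ (s≤s z≤n) k≤n M saturating)
... | inj₂ m≤n rewrite m≤n⇒m⊔n≡n m≤n =
  subst (_≤ 2 * weight M + a * suc a) (cong (λ t → 2 * (t ∸ 1)) (+-CS.xy∙z≈xz∙y (a * suc n) (suc n) (suc m)))
    (weight-bound⇒theorem-bound a n (suc m) (weight M) (saturating-weight-≥′ (s≤s z≤n) k≤m M saturating))
theorem6 (suc zero) _ _ (s≤s ()) _ _ _ _
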